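{- Let $(T,\lambda)$ be an edge-labeled phylogenetic tree that is least-resolved w.r.t. $\mathcal{X}=\mathcal{X}_{(T,\lambda)}$. Then $\mathcal{R}_I(\mathcal{X})$ identifies $T$; that is, $T$ displays every triple of $\mathcal{R}_I(\mathcal{X})$, and every phylogenetic tree with the same leaf set that displays all triples of $\mathcal{R}_I(\mathcal{X})$ is a refinement of $T$.
   Context: Phylogenetic tree: rooted, root degree $\ge2$, other inner vertices degree $\ge3$. $\lambda:E\to\{0,1\}$. $\mathcal{X}_{(T,\lambda)}$: $(x,y)$ for distinct leaves with a 1-edge on the path from $\operatorname{lca}(x,y)$ to $y$; explains means equality; valid relation: explained by some such tree. Extended contraction $(T_e,\lambda_e)$ of an edge $e=(u,v)$: contract $e$ keeping other labels; if $e$ is outer, the leaf $v$ is lost and a resulting degree-1 root is deleted, or a resulting non-root degree-2 vertex $u$ (parent $w$, child $w'$) is suppressed into an edge $(w,w')$ labeled $1$ iff $(w,u)$ or $(u,w')$ was. Least-resolved: no $(T_e,\lambda_e)$ explains $\mathcal{X}_{(T,\lambda)}$. A rooted triple $ab|c$ is displayed by $T$ if $\operatorname{lca}(a,b)\prec\operatorname{lca}(a,b,c)$. A tree $T'$ refines $T$ (same leaf set) if every cluster (set of leaves below a vertex) of $T$ is a cluster of $T'$. $\mathcal{R}_I(\mathcal{X})$ (informative triples) is the set of triples $ab|c$ on distinct $a,b,c$ of the leaf set such that every edge-labeled phylogenetic tree on $\{a,b,c\}$ explaining the restriction of $\mathcal{X}$ to $\{a,b,c\}$ has topology $ab|c$.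 -}

module Defs where

open import Data.Nat using (ℕ; zero; suc; _≤_)
open import Data.Bool using (Bool; true; false; _∨_)
open import Data.List using (List; []; _∷_; _++_; length; take; drop)
open import Data.List.Membership.Propositional using (_∈_)
open import Data.List.Relation.Unary.Unique.Propositional using (Unique)
open import Data.Maybe using (Maybe; just; nothing)
open import Data.Product using (Σ; ∃; _×_; _,_)
open import Relation.Binary.PropositionalEquality using (_≡_; _≢_)
open import Function.Bundles using (_⇔_)
open import Relation.Nullary using (¬_)

-- Rooted trees with leaves labelled by ℕ and edges labelled by Bool
-- (λ(e) = 1 is 'true').  A node carries the list of its children, each
-- paired with the label of the edge from the node to that child.

data Tree : Set where
  leaf : ℕ → Tree
  node : List (Bool × Tree) → Tree

_!!_ : {A : Set} → List A → ℕ → Maybe A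
[] !! _ = nothing
(x ∷ xs) !! zero = just x
(x ∷ xs) !! suc i = xs !! i

upd : {A : Set} → List A → ℕ → A → List A
upd [] _ _ = []
upd (x ∷ xs) zero y = y ∷ xs
upd (x ∷ xs) (suc i) y = x ∷ upd xs i y

del : {A : Set} → List A → ℕ → List A
del xs i = take i xs ++ drop (suc i) xs

splice : {A : Set} → List A → ℕ → List A → List A
splice xs i ys = take i xs ++ ys ++ drop (suc i) xs

mutual
  leaves : Tree → List ℕ
  leaves (leaf x) = x ∷ []
  leaves (node cs) = leavesL cs

  leavesL : List (Bool × Tree) → List ℕ
  leavesL [] = []
  leavesL ((_ , c) ∷ cs) = leaves c ++ leavesL cs

-- Vertices are addressed by paths of child indices from the root.

Addr : Set
Addr = List ℕ

data _∋[_]_ : Tree → Addr → Tree → Set where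
  here  : ∀ {t} → t ∋[ [] ] t
  there : ∀ {cs i p b c s} → cs !! i ≡ just (b , c) → c ∋[ p ] s →
          node cs ∋[ i ∷ p ] s

Vertex : Tree → Addr → Set
Vertex t p = ∃ λ s → t ∋[ p ] s

LeafAt : Tree → ℕ → Addr → Set
LeafAt t x p = t ∋[ p ] leaf x

-- p ≼ q : the vertex q is a descendant of (or equal to) p  (q ⪯ p in the paper)
_≼_ : Addr → Addr → Set
p ≼ q = ∃ λ s → p ++ s ≡ q

_≺_ : Addr → Addr → Set
p ≺ q = ∃ λ s → (s ≢ []) × (p ++ s ≡ q)

data EdgeLabel (t : Tree) : Addr → Bool → Set where
  edge : ∀ {q cs i b c} → t ∋[ q ] node cs → cs !! i ≡ just (b , c) →
         EdgeLabel t (q ++ i ∷ []) b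

AllBelow : Tree → List ℕ → Addr → Set
AllBelow t xs r = ∀ x → x ∈ xs → ∃ λ p → LeafAt t x p × r ≼ p

IsLCA : Tree → List ℕ → Addr → Set
IsLCA t xs r = Vertex t r × AllBelow t xs r × (∀ r' → AllBelow t xs r' → r' ≼ r)

-- Phylogenetic trees: every inner vertex has at least two children
-- (root degree ≥ 2, other inner vertices degree ≥ 3), leaf labels distinct.

Phylo : Tree → Set
Phylo t = (∀ p cs → t ∋[ p ] node cs → 2 ≤ length cs) × Unique (leaves t)

Rel₂ : Set₁
Rel₂ = ℕ → ℕ → Set

X : Tree → Rel₂
X t x y = (x ≢ y) × Σ Addr λ px → Σ Addr λ py → Σ Addr λ r →
  LeafAt t x px × LeafAt t y py × IsLCA t (x ∷ y ∷ []) r ×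
  (∃ λ q → r ≺ q × q ≼ py × EdgeLabel t q true)

SameSet : List ℕ → List ℕ → Set
SameSet L L' = ∀ x → (x ∈ L) ⇔ (x ∈ L')

Explains : Tree → Rel₂ → List ℕ → Set
Explains t R L = SameSet (leaves t) L × (∀ x y → X t x y ⇔ R x y)

-- contraction of an edge (u , v) where u is the root of the given tree,
-- not producing a degree problem at u
data Top : Tree → Tree → Set where
  inner : ∀ {cs i b ds} → cs !! i ≡ just (b , node ds) →
          Top (node cs) (node (splice cs i ds))
  outer : ∀ {cs i b x} → cs !! i ≡ just (b , leaf x) → 3 ≤ length cs →
          Top (node cs) (node (del cs i))

-- StepNR b t b' t' : t hangs below a NON-root vertex via an edge labelled b;
-- contracting an edge inside t turns it into t' hanging via an edge labelled b'.
data StepNR : Bool → Tree → Bool → Tree → Set where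
  top      : ∀ {b t t'} → Top t t' → StepNR b t b t'
  suppress : ∀ {b cs i bl x b₁ c₁} → cs !! i ≡ just (bl , leaf x) →
             del cs i ≡ (b₁ , c₁) ∷ [] →
             StepNR b (node cs) (b ∨ b₁) c₁
  deeper   : ∀ {b cs i bi ci bi' ci'} → cs !! i ≡ just (bi , ci) →
             StepNR bi ci bi' ci' →
             StepNR b (node cs) b (node (upd cs i (bi' , ci')))

-- Step t t' : t' = (T_e , λ_e) for some edge e of t (t is the whole tree)
data Step : Tree → Tree → Set where
  top        : ∀ {t t'} → Top t t' → Step t t'
  rootDelete : ∀ {cs i bl x b₁ c₁} → cs !! i ≡ just (bl , leaf x) →
               del cs i ≡ (b₁ , c₁) ∷ [] →
               Step (node cs) c₁
  deeper     : ∀ {cs i bi ci bi' ci'} → cs !! i ≡ just (bi , ci) →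
               StepNR bi ci bi' ci' →
               Step (node cs) (node (upd cs i (bi' , ci')))

LeastResolved : Tree → Set
LeastResolved t = ∀ t' → Step t t' → ¬ Explains t' (X t) (leaves t)

Displays : Tree → ℕ → ℕ → ℕ → Set
Displays t a b c = Σ Addr λ r → Σ Addr λ r' →
  IsLCA t (a ∷ b ∷ []) r × IsLCA t (a ∷ b ∷ c ∷ []) r' × r' ≺ r

Restrict : Rel₂ → List ℕ → Rel₂
Restrict R L' x y = R x y × x ∈ L' × y ∈ L'

Informative : Rel₂ → List ℕ → ℕ → ℕ → ℕ → Set
Informative R L a b c =
  a ∈ L × b ∈ L × c ∈ L × a ≢ b × a ≢ c × b ≢ c ×
  (∀ t → Phylo t → Explains t (Restrict R (a ∷ b ∷ c ∷ [])) (a ∷ b ∷ c ∷ []) →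
     Displays t a b c)

InCluster : Tree → Addr → ℕ → Set
InCluster t p x = ∃ λ q → LeafAt t x q × p ≼ q

Refines : Tree → Tree → Set
Refines t' t = SameSet (leaves t') (leaves t) ×
  (∀ p → Vertex t p → ∃ λ p' → Vertex t' p' × (∀ x → InCluster t p x ⇔ InCluster t' p' x))

module Submission where

-- The central tool is a description of 𝒳 at a branching vertex m: if x
-- and y branch at m, then (x , y) ∈ 𝒳 iff the path from m down to y carries a 1-edge
-- (X⇔onePath).
--
-- Part 1.  Three leaves of T either form a cherry (ab|c, ac|b, bc|a) or a star.
-- Whenever T does not display ab|c, a three-leaf tree labelled by the onePath values
-- of T explains 𝒳 on {a, b, c} without displaying ab|c, so ab|c is not informative.
--
-- Part 2.  A recursive description XR of 𝒳 is invariant under contracting an inner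
-- edge that is a 0-edge, or a 1-edge above which every leaf below already sees a
-- 1-edge.  So in a least-resolved T every inner edge is a 1-edge with a leaf y below
-- that sees no further 1-edge; for its cluster C, every xy|z with x ∈ C ∖ {y}, z ∉ C
-- is informative.  A tree displaying all these triples has C as a cluster, which is
-- the refinement property.

open import Defs
open import Data.Nat using (ℕ; zero; suc; _≟_; s≤s; z≤n)
open import Data.Bool using (Bool; true; false; _∨_)
open import Data.Bool.Properties using (∨-zeroʳ; ∨-assoc; ∨-identityʳ)
open import Data.Empty using (⊥; ⊥-elim)
open import Data.List using (List; []; _∷_; _++_; take; drop)
open import Data.List.Membership.DecPropositional _≟_ using (_∈?_)
open import Data.List.Membership.Propositional using (_∈_; _∉_; find)
open import Data.List.Membership.Propositional.Properties using (∈-++⁺ˡ; ∈-++⁺ʳ; ∈-++⁻)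
open import Data.List.Properties using (++-assoc; ++-identityʳ; ++-identityʳ-unique; ∷-injectiveˡ; ∷-injectiveʳ; ++-cancelˡ)
open import Data.List.Relation.Unary.All as All using (All; []; _∷_; all?)
open import Data.List.Relation.Unary.All.Properties using (++⁻ˡ; ++⁻ʳ; ¬All⇒Any¬)
open import Data.List.Relation.Unary.AllPairs using ([]; _∷_)
open import Data.List.Relation.Unary.Any using (here; there)
open import Data.List.Relation.Unary.Unique.Propositional using (Unique)
open import Data.Maybe using (Maybe; just; nothing)
open import Data.Product using (Σ; ∃; _×_; _,_; proj₁; proj₂)
open import Data.Sum using (_⊎_; inj₁; inj₂)
open import Function.Bundles using (_⇔_; mk⇔; Equivalence)
open import Relation.Binary.PropositionalEquality
open import Relation.Nullary using (¬_; Dec; yes; no)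
open Equivalence

≼-refl : ∀ p → p ≼ p
≼-refl p = [] , ++-identityʳ p

≼-trans : ∀ {p q r} → p ≼ q → q ≼ r → p ≼ r
≼-trans {p} (s , refl) (s' , refl) = s ++ s' , sym (++-assoc p s s')

≼-++ : ∀ p s → p ≼ (p ++ s)
≼-++ p s = s , refl

[]≼ : ∀ q → [] ≼ q
[]≼ q = q , refl

≼-∷⁻ : ∀ {k k' p q} → (k ∷ p) ≼ (k' ∷ q) → (k ≡ k') × (p ≼ q)
≼-∷⁻ (s , eq) = ∷-injectiveˡ eq , (s , ∷-injectiveʳ eq)

≼-∷⁺ : ∀ {k p q} → p ≼ q → (k ∷ p) ≼ (k ∷ q)
≼-∷⁺ {k} (s , eq) = s , cong (k ∷_) eq

≼[] : ∀ {p} → p ≼ [] → p ≡ []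
≼[] {[]} _ = refl
≼[] {x ∷ p} (s , ())

≼-antisym : ∀ {p q} → p ≼ q → q ≼ p → p ≡ q
≼-antisym {[]} _ q≼[] = sym (≼[] q≼[])
≼-antisym {x ∷ p} {[]} (s , ()) _
≼-antisym {x ∷ p} {y ∷ q} a b with ≼-∷⁻ a | ≼-∷⁻ b
... | refl , a' | _ , b' = cong (x ∷_) (≼-antisym a' b')

≺⇒⋡ : ∀ {p q} → p ≺ q → ¬ q ≼ p
≺⇒⋡ {p} (s , s≢[] , refl) (s' , eq) =
  s≢[] (++-conicalˡ s s' (++-identityʳ-unique p (sym (trans (sym (++-assoc p s s')) eq))))
  where
  ++-conicalˡ : ∀ (a b : Addr) → a ++ b ≡ [] → a ≡ []
  ++-conicalˡ [] b _ = refl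
  ++-conicalˡ (x ∷ a) b ()

≺-child : ∀ p i e → p ≺ (p ++ i ∷ e)
≺-child p i e = (i ∷ e) , (λ ()) , refl

≼-branch : ∀ {r} E {j j' a b} → r ≼ (E ++ j ∷ a) → r ≼ (E ++ j' ∷ b) → j ≢ j' → r ≼ E
≼-branch {[]} E _ _ _ = []≼ E
≼-branch {k ∷ r} [] p q j≢j' with ≼-∷⁻ p | ≼-∷⁻ q
... | refl , _ | refl , _ = ⊥-elim (j≢j' refl)
≼-branch {k ∷ r} (e ∷ E) p q j≢j' with ≼-∷⁻ p | ≼-∷⁻ q
... | refl , p' | _ , q' = ≼-∷⁺ (≼-branch E p' q' j≢j')

≼-comparable : ∀ {p q z} → p ≼ z → q ≼ z → (p ≼ q) ⊎ (q ≺ p)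
≼-comparable {[]} {q} _ _ = inj₁ ([]≼ q)
≼-comparable {x ∷ p} {[]} _ _ = inj₂ ((x ∷ p) , (λ ()) , refl)
≼-comparable {x ∷ p} {y ∷ q} {[]} (_ , ()) _
≼-comparable {x ∷ p} {y ∷ q} {z ∷ zs} a b with ≼-∷⁻ a | ≼-∷⁻ b
... | refl , a' | refl , b' with ≼-comparable a' b'
... | inj₁ h = inj₁ (≼-∷⁺ h)
... | inj₂ (s , ne , eq) = inj₂ (s , ne , cong (x ∷_) eq)

≺-≼-child : ∀ {E r} j a → E ≺ r → r ≼ (E ++ j ∷ a) → (E ++ j ∷ []) ≼ r
≺-≼-child {E} j a (s , s≢[] , refl) (s₂ , eq)
  with s | ++-cancelˡ E (s ++ s₂) (j ∷ a) (trans (sym (++-assoc E s s₂)) eq)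
... | [] | _ = ⊥-elim (s≢[] refl)
... | j₀ ∷ s' | eq' with ∷-injectiveˡ eq'
... | refl = s' , ++-assoc E (j ∷ []) s'

child-≼-injective : ∀ E {j j' b} → (E ++ j ∷ []) ≼ (E ++ j' ∷ b) → j ≡ j'
child-≼-injective E {j} {j'} {b} (s , eq) =
  ∷-injectiveˡ (++-cancelˡ E (j ∷ s) (j' ∷ b) (trans (sym (++-assoc E (j ∷ []) s)) eq))

Incomparable : Addr → Addr → Set
Incomparable p q = (¬ p ≼ q) × (¬ q ≼ p)

Incomparable-∷⁻ : ∀ {i p q} → Incomparable (i ∷ p) (i ∷ q) → Incomparable p q
Incomparable-∷⁻ (a , b) = (λ h → a (≼-∷⁺ h)) , (λ h → b (≼-∷⁺ h))

Branch : Addr → Addr → Set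
Branch p q = Σ Addr λ E → Σ ℕ λ j → Σ ℕ λ j' → Σ Addr λ a → Σ Addr λ b →
  (j ≢ j') × (p ≡ E ++ j ∷ a) × (q ≡ E ++ j' ∷ b)

branch : ∀ p q → Incomparable p q → Branch p q
branch [] q (n , _) = ⊥-elim (n ([]≼ q))
branch (i ∷ p) [] (_ , n) = ⊥-elim (n ([]≼ _))
branch (i ∷ p) (k ∷ q) inc with i ≟ k
... | no i≢k = [] , i , k , p , q , i≢k , refl , refl
... | yes refl with branch p q (Incomparable-∷⁻ inc)
... | E , j , j' , a , b , j≢j' , refl , refl = (i ∷ E) , j , j' , a , b , j≢j' , refl , refl

-- Shapes of three pairwise incomparable addresses: pa and pb form a cherry below a
-- vertex m from which pc branches off (the topology ab|c), or all three branch at m.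

Cherry : Addr → Addr → Addr → Set
Cherry pa pb pc = Σ Addr λ m → Σ ℕ λ i → Σ ℕ λ k → Σ Addr λ e → Σ ℕ λ j → Σ ℕ λ j' →
  Σ Addr λ qa → Σ Addr λ qb → Σ Addr λ qc →
  (i ≢ k) × (j ≢ j') × (pa ≡ m ++ i ∷ e ++ j ∷ qa) × (pb ≡ m ++ i ∷ e ++ j' ∷ qb) × (pc ≡ m ++ k ∷ qc)

Star : Addr → Addr → Addr → Set
Star pa pb pc = Σ Addr λ m → Σ ℕ λ i → Σ ℕ λ j → Σ ℕ λ k →
  Σ Addr λ qa → Σ Addr λ qb → Σ Addr λ qc →
  (i ≢ j) × (i ≢ k) × (j ≢ k) × (pa ≡ m ++ i ∷ qa) × (pb ≡ m ++ j ∷ qb) × (pc ≡ m ++ k ∷ qc)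

Topology : Addr → Addr → Addr → Set
Topology pa pb pc = Cherry pa pb pc ⊎ Cherry pa pc pb ⊎ Cherry pb pc pa ⊎ Star pa pb pc

Cherry-∷ : ∀ {h pa pb pc} → Cherry pa pb pc → Cherry (h ∷ pa) (h ∷ pb) (h ∷ pc)
Cherry-∷ {h} (m , i , k , e , j , j' , qa , qb , qc , n₁ , n₂ , refl , refl , refl) =
  (h ∷ m) , i , k , e , j , j' , qa , qb , qc , n₁ , n₂ , refl , refl , refl

Star-∷ : ∀ {h pa pb pc} → Star pa pb pc → Star (h ∷ pa) (h ∷ pb) (h ∷ pc)
Star-∷ {h} (m , i , j , k , qa , qb , qc , n₁ , n₂ , n₃ , refl , refl , refl) =
  (h ∷ m) , i , j , k , qa , qb , qc , n₁ , n₂ , n₃ , refl , refl , refl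

cherry-at-root : ∀ {i k} pa pb pc → i ≢ k → Incomparable pa pb → Cherry (i ∷ pa) (i ∷ pb) (k ∷ pc)
cherry-at-root {i} {k} pa pb pc i≢k inc with branch pa pb inc
... | E , j , j' , a , b , j≢j' , refl , refl = [] , i , k , E , j , j' , a , b , pc , i≢k , j≢j' , refl , refl , refl

topology : ∀ pa pb pc → Incomparable pa pb → Incomparable pa pc → Incomparable pb pc → Topology pa pb pc
topology [] pb pc (n , _) _ _ = ⊥-elim (n ([]≼ pb))
topology (i ∷ pa) [] pc (_ , n) _ _ = ⊥-elim (n ([]≼ _))
topology (i ∷ pa) (j ∷ pb) [] _ (_ , n) _ = ⊥-elim (n ([]≼ _))
topology (i ∷ pa) (j ∷ pb) (k ∷ pc) iab iac ibc with i ≟ j | i ≟ k | j ≟ k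
... | yes refl | yes refl | _ with topology pa pb pc (Incomparable-∷⁻ iab) (Incomparable-∷⁻ iac) (Incomparable-∷⁻ ibc)
...   | inj₁ c = inj₁ (Cherry-∷ c)
...   | inj₂ (inj₁ c) = inj₂ (inj₁ (Cherry-∷ c))
...   | inj₂ (inj₂ (inj₁ c)) = inj₂ (inj₂ (inj₁ (Cherry-∷ c)))
...   | inj₂ (inj₂ (inj₂ s)) = inj₂ (inj₂ (inj₂ (Star-∷ s)))
topology (i ∷ pa) (j ∷ pb) (k ∷ pc) iab iac ibc | yes refl | no i≢k | _ =
  inj₁ (cherry-at-root pa pb pc i≢k (Incomparable-∷⁻ iab))
topology (i ∷ pa) (j ∷ pb) (k ∷ pc) iab iac ibc | no i≢j | yes refl | _ =
  inj₂ (inj₁ (cherry-at-root pa pc pb i≢j (Incomparable-∷⁻ iac)))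
topology (i ∷ pa) (j ∷ pb) (k ∷ pc) iab iac ibc | no i≢j | no _ | yes refl =
  inj₂ (inj₂ (inj₁ (cherry-at-root pb pc pa (λ e → i≢j (sym e)) (Incomparable-∷⁻ ibc))))
topology (i ∷ pa) (j ∷ pb) (k ∷ pc) iab iac ibc | no i≢j | no i≢k | no j≢k =
  inj₂ (inj₂ (inj₂ ([] , i , j , k , pa , pb , pc , i≢j , i≢k , j≢k , refl , refl , refl)))

∋-functional : ∀ {t p s s'} → t ∋[ p ] s → t ∋[ p ] s' → s ≡ s'
∋-functional here here = refl
∋-functional (there e h) (there e' h') with trans (sym e) e'
... | refl = ∋-functional h h'

∋-++ : ∀ {t p q s u} → t ∋[ p ] s → s ∋[ q ] u → t ∋[ p ++ q ] u
∋-++ here h = h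
∋-++ (there e h) h' = there e (∋-++ h h')

∋-split : ∀ {t} p {q u} → t ∋[ p ++ q ] u → ∃ λ s → (t ∋[ p ] s) × (s ∋[ q ] u)
∋-split [] h = _ , here , h
∋-split (i ∷ p) (there e h) with ∋-split p h
... | s , h₁ , h₂ = s , there e h₁ , h₂

subtree : ∀ {t} p {q u} → t ∋[ p ++ q ] u → Tree
subtree p h = proj₁ (∋-split p h)

subtree-at : ∀ {t} p {q u} (h : t ∋[ p ++ q ] u) → t ∋[ p ] subtree p h
subtree-at p h = proj₁ (proj₂ (∋-split p h))

subtree-∋ : ∀ {t} p {q u} (h : t ∋[ p ++ q ] u) → subtree p h ∋[ q ] u
subtree-∋ p h = proj₂ (proj₂ (∋-split p h))

leaf-∋ : ∀ {x q u} → leaf x ∋[ q ] u → (q ≡ []) × (u ≡ leaf x)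
leaf-∋ here = refl , refl

leaf-∌-node : ∀ {x p cs} → ¬ leaf x ∋[ p ] node cs
leaf-∌-node h with leaf-∋ h
... | _ , ()

parent : ∀ {t k p S} → t ∋[ k ∷ p ] S →
  Σ Addr λ q → Σ ℕ λ i → Σ (List (Bool × Tree)) λ cs → Σ Bool λ b → (t ∋[ q ] node cs) × (cs !! i ≡ just (b , S))
parent {p = []} (there e here) = [] , _ , _ , _ , here , e
parent {p = k' ∷ p'} (there e h) with parent h
... | q , i , cs , b , h' , e' = (_ ∷ q) , i , cs , b , there e h' , e'

leaf-below-leaf : ∀ {t x y p q} → LeafAt t x p → LeafAt t y q → p ≼ q → x ≡ y
leaf-below-leaf {p = p} hx hy (s , refl) with ∋-split p hy
... | s' , h₁ , h₂ with ∋-functional hx h₁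
... | refl with leaf-∋ h₂
... | refl , refl = refl

leaves-incomparable : ∀ {t x y p q} → LeafAt t x p → LeafAt t y q → x ≢ y → Incomparable p q
leaves-incomparable hx hy x≢y = (λ h → x≢y (leaf-below-leaf hx hy h)) , (λ h → x≢y (sym (leaf-below-leaf hy hx h)))

mutual
  leaf-address : ∀ {x} t → x ∈ leaves t → ∃ λ p → LeafAt t x p
  leaf-address (leaf y) (here refl) = [] , here
  leaf-address (node cs) m with leaf-address-children cs m
  ... | i , p , b , c , e , h = (i ∷ p) , there e h

  leaf-address-children : ∀ {x} cs → x ∈ leavesL cs →
    Σ ℕ λ i → Σ Addr λ p → Σ Bool λ b → Σ Tree λ c → (cs !! i ≡ just (b , c)) × (c ∋[ p ] leaf x)
  leaf-address-children ((b , c) ∷ cs) m with ∈-++⁻ (leaves c) m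
  ... | inj₁ m₁ with leaf-address c m₁
  ...   | p , h = 0 , p , b , c , refl , h
  leaf-address-children ((b , c) ∷ cs) m | inj₂ m₂ with leaf-address-children cs m₂
  ... | i , p , b' , c' , e , h = suc i , p , b' , c' , e , h

child-leaves-⊆ : ∀ {x} cs {i b c} → cs !! i ≡ just (b , c) → x ∈ leaves c → x ∈ leavesL cs
child-leaves-⊆ ((b , c) ∷ cs) {zero} refl m = ∈-++⁺ˡ m
child-leaves-⊆ ((b , c) ∷ cs) {suc i} e m = ∈-++⁺ʳ (leaves c) (child-leaves-⊆ cs e m)

subtree-leaves-⊆ : ∀ {t p s x} → t ∋[ p ] s → x ∈ leaves s → x ∈ leaves t
subtree-leaves-⊆ here m = m
subtree-leaves-⊆ {node cs} (there e h) m = child-leaves-⊆ cs e (subtree-leaves-⊆ h m)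

leafAt-∈ : ∀ {t x p} → LeafAt t x p → x ∈ leaves t
leafAt-∈ h = subtree-leaves-⊆ h (here refl)

cluster-subtree : ∀ {t p S z} → t ∋[ p ] S → InCluster t p z ⇔ z ∈ leaves S
cluster-subtree {t} {p} {S} {z} h = mk⇔ to′ from′
  where
  to′ : InCluster t p z → z ∈ leaves S
  to′ (q , hz , (d , refl)) with ∋-split p hz
  ... | S' , h₁ , h₂ with ∋-functional h h₁
  ... | refl = leafAt-∈ h₂
  from′ : z ∈ leaves S → InCluster t p z
  from′ m with leaf-address S m
  ... | d , hd = (p ++ d) , ∋-++ h hd , ≼-++ p d

cluster-leaf : ∀ {t x p z} → LeafAt t x p → InCluster t p z ⇔ z ≡ x
cluster-leaf {p = p} h = mk⇔ (λ { (q , hz , pq) → sym (leaf-below-leaf h hz pq) }) (λ { refl → p , h , ≼-refl p })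

unique-++⁻ : ∀ (xs : List ℕ) {ys} → Unique (xs ++ ys) → Unique xs × Unique ys × (∀ {x} → x ∈ xs → x ∉ ys)
unique-++⁻ [] u = [] , u , λ ()
unique-++⁻ (x ∷ xs) (x∉ ∷ u) with unique-++⁻ xs u
... | uxs , uys , disjoint = ++⁻ˡ xs x∉ ∷ uxs , uys , disjoint′
  where
  disjoint′ : ∀ {z} → z ∈ x ∷ xs → z ∉ _
  disjoint′ (here refl) m = All.lookup (++⁻ʳ xs x∉) m refl
  disjoint′ (there m) = disjoint m

unique-child : ∀ cs {i b c} → Unique (leavesL cs) → cs !! i ≡ just (b , c) → Unique (leaves c)
unique-child ((b , c) ∷ cs) {zero} u refl = proj₁ (unique-++⁻ (leaves c) u)
unique-child ((b , c) ∷ cs) {suc i} u e = unique-child cs (proj₁ (proj₂ (unique-++⁻ (leaves c) u))) e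

unique-subtree : ∀ {t p s} → Unique (leaves t) → t ∋[ p ] s → Unique (leaves s)
unique-subtree u here = u
unique-subtree {node cs} u (there e h) = unique-subtree (unique-child cs u e) h

child-index-unique : ∀ cs {i j b c b' c' x} → Unique (leavesL cs) →
  cs !! i ≡ just (b , c) → cs !! j ≡ just (b' , c') → x ∈ leaves c → x ∈ leaves c' → i ≡ j
child-index-unique ((b , c) ∷ cs) {zero} {zero} u e e' m m' = refl
child-index-unique ((b , c) ∷ cs) {zero} {suc j} u refl e' m m' =
  ⊥-elim (proj₂ (proj₂ (unique-++⁻ (leaves c) u)) m (child-leaves-⊆ cs e' m'))
child-index-unique ((b , c) ∷ cs) {suc i} {zero} u e refl m m' =
  ⊥-elim (proj₂ (proj₂ (unique-++⁻ (leaves c) u)) m' (child-leaves-⊆ cs e m))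
child-index-unique ((b , c) ∷ cs) {suc i} {suc j} u e e' m m' =
  cong suc (child-index-unique cs (proj₁ (proj₂ (unique-++⁻ (leaves c) u))) e e' m m')

leaf-address-unique : ∀ {t x p q} → Unique (leaves t) → LeafAt t x p → LeafAt t x q → p ≡ q
leaf-address-unique u here here = refl
leaf-address-unique {node cs} u (there e h) (there e' h')
  with child-index-unique cs u e e' (leafAt-∈ h) (leafAt-∈ h')
... | refl with trans (sym e) e'
... | refl = cong (_ ∷_) (leaf-address-unique (unique-child cs u e) h h')

below₂ : ∀ {t x y px py E} → LeafAt t x px → LeafAt t y py → E ≼ px → E ≼ py → AllBelow t (x ∷ y ∷ []) E
below₂ hx hy a b z (here refl) = _ , hx , a
below₂ hx hy a b z (there (here refl)) = _ , hy , b

below₃ : ∀ {t x y w px py pw E} → LeafAt t x px → LeafAt t y py → LeafAt t w pw →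
  E ≼ px → E ≼ py → E ≼ pw → AllBelow t (x ∷ y ∷ w ∷ []) E
below₃ hx hy hw a b c z (here refl) = _ , hx , a
below₃ hx hy hw a b c z (there (here refl)) = _ , hy , b
below₃ hx hy hw a b c z (there (there (here refl))) = _ , hw , c

lca-at-branch : ∀ {t x y} E {j j' a b} xs → Unique (leaves t) →
  LeafAt t x (E ++ j ∷ a) → LeafAt t y (E ++ j' ∷ b) → j ≢ j' → x ∈ xs → y ∈ xs →
  AllBelow t xs E → IsLCA t xs E
lca-at-branch {t} E xs u hx hy j≢j' mx my below =
  (subtree E hx , subtree-at E hx) , below , maximal
  where
  maximal : ∀ r' → AllBelow t xs r' → r' ≼ E
  maximal r' below' with below' _ mx | below' _ my
  ... | px , hx' , r'≼px | py , hy' , r'≼py with leaf-address-unique u hx hx' | leaf-address-unique u hy hy'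
  ... | refl | refl = ≼-branch E r'≼px r'≼py j≢j'

lca₂-at-branch : ∀ {t x y} E {j j' a b} → Unique (leaves t) →
  LeafAt t x (E ++ j ∷ a) → LeafAt t y (E ++ j' ∷ b) → j ≢ j' → IsLCA t (x ∷ y ∷ []) E
lca₂-at-branch E u hx hy j≢j' =
  lca-at-branch E _ u hx hy j≢j' (here refl) (there (here refl)) (below₂ hx hy (≼-++ E _) (≼-++ E _))

lca-unique : ∀ {t xs r r'} → IsLCA t xs r → IsLCA t xs r' → r ≡ r'
lca-unique (_ , a , m) (_ , a' , m') = ≼-antisym (m' _ a) (m _ a')

branch-≢ : ∀ {t x y} E {j j' a b} → Unique (leaves t) →
  LeafAt t x (E ++ j ∷ a) → LeafAt t y (E ++ j' ∷ b) → j ≢ j' → x ≢ y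
branch-≢ E {j} {j'} {a} {b} u hx hy j≢j' refl =
  j≢j' (∷-injectiveˡ (++-cancelˡ E (j ∷ a) (j' ∷ b) (leaf-address-unique u hx hy)))

mutual
  onePath : Tree → Addr → Bool
  onePath (leaf _) _ = false
  onePath (node cs) [] = false
  onePath (node cs) (i ∷ d) = onePathVia (cs !! i) d

  onePathVia : Maybe (Bool × Tree) → Addr → Bool
  onePathVia nothing _ = false
  onePathVia (just (b , c)) d = b ∨ onePath c d

onePath-∷ : ∀ {cs i b c} d → cs !! i ≡ just (b , c) → onePath (node cs) (i ∷ d) ≡ b ∨ onePath c d
onePath-∷ d e rewrite e = refl

onePath-++ : ∀ {S S'} e d → S ∋[ e ] S' → onePath S (e ++ d) ≡ onePath S e ∨ onePath S' d
onePath-++ {leaf x} [] d here = refl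
onePath-++ {node cs} [] d here = refl
onePath-++ {node cs} {S'} (k ∷ e) d (there {b = b} {c = c} l h) = begin
  onePath (node cs) (k ∷ e ++ d)        ≡⟨ onePath-∷ {cs} (e ++ d) l ⟩
  b ∨ onePath c (e ++ d)                ≡⟨ cong (b ∨_) (onePath-++ e d h) ⟩
  b ∨ (onePath c e ∨ onePath S' d)      ≡⟨ sym (∨-assoc b _ _) ⟩
  (b ∨ onePath c e) ∨ onePath S' d      ≡⟨ cong (_∨ onePath S' d) (sym (onePath-∷ {cs} e l)) ⟩
  onePath (node cs) (k ∷ e) ∨ onePath S' d ∎
  where open ≡-Reasoning

edge-inv : ∀ {t a b} → EdgeLabel t a b →
  Σ Addr λ q → Σ (List (Bool × Tree)) λ cs → Σ ℕ λ i → Σ Tree λ c →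
    (t ∋[ q ] node cs) × (cs !! i ≡ just (b , c)) × (a ≡ q ++ i ∷ [])
edge-inv (edge {q} {cs} {i} {b} {c} h l) = q , cs , i , c , h , l , refl

edge-∷⁺ : ∀ {cs i b c q b'} → cs !! i ≡ just (b , c) → EdgeLabel c q b' → EdgeLabel (node cs) (i ∷ q) b'
edge-∷⁺ e el with edge-inv el
... | _ , _ , _ , _ , h , l , refl = edge (there e h) l

edge-∷⁻ : ∀ {cs k b c q b'} → cs !! k ≡ just (b , c) → EdgeLabel (node cs) (k ∷ q) b' → q ≢ [] → EdgeLabel c q b'
edge-∷⁻ e el q≢[] with edge-inv el
... | [] , _ , _ , _ , h , l , refl = ⊥-elim (q≢[] refl)
... | (k₀ ∷ q₀) , _ , _ , _ , there e₀ h₀ , l , refl with trans (sym e) e₀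
... | refl = edge h₀ l

edge⇒onePath : ∀ {t q₀ cs i c d} → t ∋[ q₀ ] node cs → cs !! i ≡ just (true , c) → (q₀ ++ i ∷ []) ≼ d →
  onePath t d ≡ true
edge⇒onePath here e (s , refl) rewrite e = refl
edge⇒onePath {q₀ = k ∷ _} (there {cs = cs} {b = bk} e h) l (s , refl) =
  trans (onePath-∷ {cs} _ e) (trans (cong (bk ∨_) (edge⇒onePath h l (s , refl))) (∨-zeroʳ bk))

onePath⇒edge : ∀ t d → onePath t d ≡ true → Σ Addr λ q → (q ≢ []) × (q ≼ d) × EdgeLabel t q true
onePath⇒edge (leaf x) d ()
onePath⇒edge (node cs) [] ()
onePath⇒edge (node cs) (i ∷ d) o with cs !! i in e
onePath⇒edge (node cs) (i ∷ d) () | nothing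
onePath⇒edge (node cs) (i ∷ d) o | just (true , c) = (i ∷ []) , (λ ()) , (d , refl) , edge here e
onePath⇒edge (node cs) (i ∷ d) o | just (false , c) with onePath⇒edge c d o
... | q , _ , q≼d , el = (i ∷ q) , (λ ()) , ≼-∷⁺ q≼d , edge-∷⁺ e el

edge-below⇒onePath : ∀ {t m S q} d → t ∋[ m ] S → m ≺ q → q ≼ (m ++ d) → EdgeLabel t q true →
  onePath S d ≡ true
edge-below⇒onePath d here (s , _ , refl) q≼d el with edge-inv el
... | _ , _ , _ , _ , h , l , refl = edge⇒onePath h l q≼d
edge-below⇒onePath d (there e h) (s , s≢[] , refl) q≼d el =
  edge-below⇒onePath d h (s , s≢[] , refl) (proj₂ (≼-∷⁻ q≼d)) (edge-∷⁻ e el (λ eq → s≢[] (++-conicalʳ eq)))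
  where
  ++-conicalʳ : ∀ {m' s' : Addr} → m' ++ s' ≡ [] → s' ≡ []
  ++-conicalʳ {[]} eq = eq

onePath⇒edge-below : ∀ {t m S} d → t ∋[ m ] S → onePath S d ≡ true →
  Σ Addr λ q → (m ≺ q) × (q ≼ (m ++ d)) × EdgeLabel t q true
onePath⇒edge-below {t} d here o with onePath⇒edge t d o
... | q , q≢[] , q≼d , el = q , (q , q≢[] , refl) , q≼d , el
onePath⇒edge-below d (there e h) o with onePath⇒edge-below d h o
... | q , (s , s≢[] , refl) , q≼d , el = (_ ∷ q) , (s , s≢[] , refl) , ≼-∷⁺ q≼d , edge-∷⁺ e el

X⇔onePath : ∀ {t x y} m {i j qx qy S} → Unique (leaves t) →
  LeafAt t x (m ++ i ∷ qx) → LeafAt t y (m ++ j ∷ qy) → i ≢ j → t ∋[ m ] S →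
  X t x y ⇔ (onePath S (j ∷ qy) ≡ true)
X⇔onePath {t} {x} {y} m u hx hy i≢j hS = mk⇔ to′ from′
  where
  lca = lca₂-at-branch m u hx hy i≢j
  to′ : X t x y → _
  to′ (_ , _ , _ , r , hx' , hy' , lca' , q , r≺q , q≼py , el)
    with leaf-address-unique u hx hx' | leaf-address-unique u hy hy'
  ... | refl | refl with lca-unique lca' lca
  ... | refl = edge-below⇒onePath _ hS r≺q q≼py el
  from′ : _ → X t x y
  from′ o with onePath⇒edge-below _ hS o
  ... | q , m≺q , q≼py , el = branch-≢ m u hx hy i≢j , _ , _ , m , hx , hy , lca , q , m≺q , q≼py , el

-- reassociate a cherry address so that the branching vertex m ++ i ∷ e is explicit
cherry-addr : ∀ {t x} m i e j q → LeafAt t x (m ++ i ∷ e ++ j ∷ q) → LeafAt t x ((m ++ i ∷ e) ++ j ∷ q)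
cherry-addr m i e j q h = subst (LeafAt _ _) (sym (++-assoc m (i ∷ e) (j ∷ q))) h

-- a cherry ab|c in t is displayed: lca(a,b) = m ++ i ∷ e lies strictly below lca(a,b,c) = m
cherry-displays : ∀ {t a b c pa pb pc} → Unique (leaves t) →
  LeafAt t a pa → LeafAt t b pb → LeafAt t c pc → Cherry pa pb pc → Displays t a b c
cherry-displays u ha hb hc (m , i , k , e , j , j' , qa , qb , qc , i≢k , j≢j' , refl , refl , refl) =
  (m ++ i ∷ e) , m ,
  lca₂-at-branch (m ++ i ∷ e) u (cherry-addr m i e j qa ha) (cherry-addr m i e j' qb hb) j≢j' ,
  lca-at-branch m _ u ha hc i≢k (here refl) (there (there (here refl)))
    (below₃ ha hb hc (≼-++ m _) (≼-++ m _) (≼-++ m _)) ,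
  ≺-child m i e

¬displays-root-split : ∀ {s a b c i j qa qb} → Unique (leaves s) →
  LeafAt s a (i ∷ qa) → LeafAt s b (j ∷ qb) → i ≢ j → ¬ Displays s a b c
¬displays-root-split u ha hb i≢j (r , r' , lca-ab , _ , r'≺r)
  with lca-unique lca-ab (lca₂-at-branch [] u ha hb i≢j)
... | refl = ≺⇒⋡ r'≺r ([]≼ r')

SetOf₃ : List ℕ → ℕ → ℕ → ℕ → Set
SetOf₃ L a b c = (∀ z → z ∈ L → (z ≡ a) ⊎ (z ≡ b) ⊎ (z ≡ c)) × (a ∈ L) × (b ∈ L) × (c ∈ L)

SetOf₃-swap : ∀ {L a b c} → SetOf₃ L a b c → SetOf₃ L b a c
SetOf₃-swap (only , ma , mb , mc) = only′ , mb , ma , mc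
  where
  only′ : ∀ z → z ∈ _ → _
  only′ z m with only z m
  ... | inj₁ e = inj₂ (inj₁ e)
  ... | inj₂ (inj₁ e) = inj₁ e
  ... | inj₂ (inj₂ e) = inj₂ (inj₂ e)

SetOf₃-list : ∀ a b c → SetOf₃ (a ∷ b ∷ c ∷ []) a b c
SetOf₃-list a b c = only , here refl , there (here refl) , there (there (here refl))
  where
  only : ∀ z → z ∈ (a ∷ b ∷ c ∷ []) → _
  only z (here e) = inj₁ e
  only z (there (here e)) = inj₂ (inj₁ e)
  only z (there (there (here e))) = inj₂ (inj₂ e)

module _ {s t : Tree} {a b c : ℕ}
  (ab : X s a b ⇔ X t a b) (ba : X s b a ⇔ X t b a) (ac : X s a c ⇔ X t a c)
  (ca : X s c a ⇔ X t c a) (bc : X s b c ⇔ X t b c) (cb : X s c b ⇔ X t c b) where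

  private
    pair : ∀ {x y} → (x ≡ a) ⊎ (x ≡ b) ⊎ (x ≡ c) → (y ≡ a) ⊎ (y ≡ b) ⊎ (y ≡ c) → x ≢ y → X s x y ⇔ X t x y
    pair (inj₁ refl) (inj₁ refl) x≢y = ⊥-elim (x≢y refl)
    pair (inj₁ refl) (inj₂ (inj₁ refl)) _ = ab
    pair (inj₁ refl) (inj₂ (inj₂ refl)) _ = ac
    pair (inj₂ (inj₁ refl)) (inj₁ refl) _ = ba
    pair (inj₂ (inj₁ refl)) (inj₂ (inj₁ refl)) x≢y = ⊥-elim (x≢y refl)
    pair (inj₂ (inj₁ refl)) (inj₂ (inj₂ refl)) _ = bc
    pair (inj₂ (inj₂ refl)) (inj₁ refl) _ = ca
    pair (inj₂ (inj₂ refl)) (inj₂ (inj₁ refl)) _ = cb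
    pair (inj₂ (inj₂ refl)) (inj₂ (inj₂ refl)) x≢y = ⊥-elim (x≢y refl)

    back : ∀ {L' z} → (z ≡ a) ⊎ (z ≡ b) ⊎ (z ≡ c) → a ∈ L' → b ∈ L' → c ∈ L' → z ∈ L'
    back (inj₁ refl) m₁ _ _ = m₁
    back (inj₂ (inj₁ refl)) _ m₂ _ = m₂
    back (inj₂ (inj₂ refl)) _ _ m₃ = m₃

  explains-restriction : ∀ L → SetOf₃ L a b c → SetOf₃ (leaves s) a b c → Explains s (Restrict (X t) L) L
  explains-restriction L (onlyL , aL , bL , cL) (onlyS , aS , bS , cS) = same , rel
    where
    same : SameSet (leaves s) L
    same z = mk⇔ (λ m → back (onlyS z m) aL bL cL) (λ m → back (onlyL z m) aS bS cS)
    rel : ∀ x y → X s x y ⇔ Restrict (X t) L x y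
    rel x y = mk⇔ to′ from′
      where
      to′ : X s x y → Restrict (X t) L x y
      to′ h@(x≢y , _ , _ , _ , hx , hy , _) =
        let ex = onlyS x (leafAt-∈ hx) ; ey = onlyS y (leafAt-∈ hy) in
        to (pair ex ey x≢y) h , back ex aL bL cL , back ey aL bL cL
      from′ : Restrict (X t) L x y → X s x y
      from′ (h@(x≢y , _) , mx , my) = from (pair (onlyL x mx) (onlyL y my) x≢y) h

⇔-via-bool : ∀ {P Q : Set} {B₁ B₂ : Bool} → P ⇔ (B₁ ≡ true) → Q ⇔ (B₂ ≡ true) → B₁ ≡ B₂ → P ⇔ Q
⇔-via-bool p q refl = mk⇔ (λ x → from q (to p x)) (λ x → from p (to q x))

cherryTree : Bool → Bool → Bool → Bool → ℕ → ℕ → ℕ → Tree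
cherryTree β g α γ a b c = node ((β , leaf b) ∷ (g , node ((α , leaf a) ∷ (γ , leaf c) ∷ [])) ∷ [])

starTree : Bool → Bool → Bool → ℕ → ℕ → ℕ → Tree
starTree α β γ a b c = node ((α , leaf a) ∷ (β , leaf b) ∷ (γ , leaf c) ∷ [])

cherryTree-phylo : ∀ {β g α γ a b c} → a ≢ b → a ≢ c → b ≢ c → Phylo (cherryTree β g α γ a b c)
cherryTree-phylo a≢b a≢c b≢c = degrees , (≢-sym a≢b ∷ b≢c ∷ []) ∷ (a≢c ∷ []) ∷ [] ∷ []
  where
  degrees : ∀ p cs → cherryTree _ _ _ _ _ _ _ ∋[ p ] node cs → _
  degrees .[] _ here = s≤s (s≤s z≤n)
  degrees (zero ∷ p) cs (there refl h) = ⊥-elim (leaf-∌-node h)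
  degrees (suc zero ∷ []) cs (there refl here) = s≤s (s≤s z≤n)
  degrees (suc zero ∷ zero ∷ p) cs (there refl (there refl h)) = ⊥-elim (leaf-∌-node h)
  degrees (suc zero ∷ suc zero ∷ p) cs (there refl (there refl h)) = ⊥-elim (leaf-∌-node h)
  degrees (suc zero ∷ suc (suc _) ∷ p) cs (there refl (there () h))
  degrees (suc (suc _) ∷ p) cs (there () h)

starTree-phylo : ∀ {α β γ a b c} → a ≢ b → a ≢ c → b ≢ c → Phylo (starTree α β γ a b c)
starTree-phylo a≢b a≢c b≢c = degrees , (a≢b ∷ a≢c ∷ []) ∷ (b≢c ∷ []) ∷ [] ∷ []
  where
  degrees : ∀ p cs → starTree _ _ _ _ _ _ ∋[ p ] node cs → _
  degrees .[] _ here = s≤s (s≤s z≤n)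
  degrees (zero ∷ p) cs (there refl h) = ⊥-elim (leaf-∌-node h)
  degrees (suc zero ∷ p) cs (there refl h) = ⊥-elim (leaf-∌-node h)
  degrees (suc (suc zero) ∷ p) cs (there refl h) = ⊥-elim (leaf-∌-node h)
  degrees (suc (suc (suc _)) ∷ p) cs (there () h)

-- If a, c form a cherry in t with b outside, then the tree b | (a , c), labelled by
-- the onePath values of t, explains 𝒳_t on {a, b, c} but displays neither ab|c nor ba|c.
refute-cherry : ∀ {t a b c pa pb pc} → Unique (leaves t) →
  LeafAt t a pa → LeafAt t b pb → LeafAt t c pc → a ≢ b → a ≢ c → b ≢ c →
  Cherry pa pc pb → ∀ L → SetOf₃ L a b c →
  Σ Tree λ s → Phylo s × Explains s (Restrict (X t) L) L × (¬ Displays s a b c) × (¬ Displays s b a c)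
refute-cherry {t} {a} {b} {c} u ha hb hc a≢b a≢c b≢c
  (m , i , k , e , j , j' , qa , qc , qb , i≢k , j≢j' , refl , refl , refl) L L≡abc =
  s , phylo , explains-restriction {s} {t} Xab Xba Xac Xca Xbc Xcb L L≡abc sS ,
  ¬displays-root-split us haS hbS (λ ()) , ¬displays-root-split us hbS haS (λ ())
  where
  S = subtree m ha
  hS = subtree-at m ha
  W = subtree (i ∷ e) (subtree-∋ m ha)
  hSW : S ∋[ i ∷ e ] W
  hSW = subtree-at (i ∷ e) (subtree-∋ m ha)
  hW : t ∋[ m ++ i ∷ e ] W
  hW = ∋-++ hS hSW
  β = onePath S (k ∷ qb)
  g = onePath S (i ∷ e)
  α = onePath W (j ∷ qa)
  γ = onePath W (j' ∷ qc)
  s = cherryTree β g α γ a b c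
  phylo = cherryTree-phylo {β} {g} {α} {γ} a≢b a≢c b≢c
  us = proj₂ phylo
  sS : SetOf₃ (leaves s) a b c
  sS = SetOf₃-swap (SetOf₃-list b a c)
  haS : LeafAt s a (1 ∷ 0 ∷ [])
  haS = there refl (there refl here)
  hbS : LeafAt s b (0 ∷ [])
  hbS = there refl here
  hcS : LeafAt s c (1 ∷ 1 ∷ [])
  hcS = there refl (there refl here)
  hIn : s ∋[ 1 ∷ [] ] node ((α , leaf a) ∷ (γ , leaf c) ∷ [])
  hIn = there refl here
  ha' = cherry-addr m i e j qa ha
  hc' = cherry-addr m i e j' qc hc
  Xab = ⇔-via-bool (X⇔onePath [] us haS hbS (λ ()) here) (X⇔onePath m u ha hb i≢k hS) (∨-identityʳ β)
  Xcb = ⇔-via-bool (X⇔onePath [] us hcS hbS (λ ()) here) (X⇔onePath m u hc hb i≢k hS) (∨-identityʳ β)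
  Xba = ⇔-via-bool (X⇔onePath [] us hbS haS (λ ()) here) (X⇔onePath m u hb ha (≢-sym i≢k) hS)
          (trans (cong (g ∨_) (∨-identityʳ α)) (sym (onePath-++ (i ∷ e) (j ∷ qa) hSW)))
  Xbc = ⇔-via-bool (X⇔onePath [] us hbS hcS (λ ()) here) (X⇔onePath m u hb hc (≢-sym i≢k) hS)
          (trans (cong (g ∨_) (∨-identityʳ γ)) (sym (onePath-++ (i ∷ e) (j' ∷ qc) hSW)))
  Xac = ⇔-via-bool (X⇔onePath (1 ∷ []) us haS hcS (λ ()) hIn) (X⇔onePath (m ++ i ∷ e) u ha' hc' j≢j' hW)
          (∨-identityʳ γ)
  Xca = ⇔-via-bool (X⇔onePath (1 ∷ []) us hcS haS (λ ()) hIn) (X⇔onePath (m ++ i ∷ e) u hc' ha' (≢-sym j≢j') hW)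
          (∨-identityʳ α)

-- If a, b, c branch at a common vertex of t, the star on {a, b, c} with the onePath
-- labels of t explains 𝒳_t on {a, b, c} and does not display ab|c.
refute-star : ∀ {t a b c pa pb pc} → Unique (leaves t) →
  LeafAt t a pa → LeafAt t b pb → LeafAt t c pc → a ≢ b → a ≢ c → b ≢ c →
  Star pa pb pc → ∀ L → SetOf₃ L a b c →
  Σ Tree λ s → Phylo s × Explains s (Restrict (X t) L) L × (¬ Displays s a b c)
refute-star {t} {a} {b} {c} u ha hb hc a≢b a≢c b≢c
  (m , i , j , k , qa , qb , qc , i≢j , i≢k , j≢k , refl , refl , refl) L L≡abc =
  s , phylo , explains-restriction {s} {t} Xab Xba Xac Xca Xbc Xcb L L≡abc (SetOf₃-list a b c) ,
  ¬displays-root-split us haS hbS (λ ())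
  where
  S = subtree m ha
  hS = subtree-at m ha
  α = onePath S (i ∷ qa)
  β = onePath S (j ∷ qb)
  γ = onePath S (k ∷ qc)
  s = starTree α β γ a b c
  phylo = starTree-phylo {α} {β} {γ} a≢b a≢c b≢c
  us = proj₂ phylo
  haS : LeafAt s a (0 ∷ [])
  haS = there refl here
  hbS : LeafAt s b (1 ∷ [])
  hbS = there refl here
  hcS : LeafAt s c (2 ∷ [])
  hcS = there refl here
  Xab = ⇔-via-bool (X⇔onePath [] us haS hbS (λ ()) here) (X⇔onePath m u ha hb i≢j hS) (∨-identityʳ β)
  Xcb = ⇔-via-bool (X⇔onePath [] us hcS hbS (λ ()) here) (X⇔onePath m u hc hb (≢-sym j≢k) hS) (∨-identityʳ β)
  Xba = ⇔-via-bool (X⇔onePath [] us hbS haS (λ ()) here) (X⇔onePath m u hb ha (≢-sym i≢j) hS) (∨-identityʳ α)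
  Xca = ⇔-via-bool (X⇔onePath [] us hcS haS (λ ()) here) (X⇔onePath m u hc ha (≢-sym i≢k) hS) (∨-identityʳ α)
  Xac = ⇔-via-bool (X⇔onePath [] us haS hcS (λ ()) here) (X⇔onePath m u ha hc i≢k hS) (∨-identityʳ γ)
  Xbc = ⇔-via-bool (X⇔onePath [] us hbS hcS (λ ()) here) (X⇔onePath m u hb hc j≢k hS) (∨-identityʳ γ)

-- T displays every informative triple ab|c: otherwise a, b, c have topology ac|b,
-- bc|a or a star in T, and the matching counterexample contradicts informativity.
informative-displayed : ∀ t → Phylo t → (a b c : ℕ) → Informative (X t) (leaves t) a b c → Displays t a b c
informative-displayed t (_ , u) a b c (ma , mb , mc , a≢b , a≢c , b≢c , forced)
  with leaf-address t ma | leaf-address t mb | leaf-address t mc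
... | pa , ha | pb , hb | pc , hc
  with topology pa pb pc (leaves-incomparable ha hb a≢b) (leaves-incomparable ha hc a≢c) (leaves-incomparable hb hc b≢c)
... | inj₁ ab|c = cherry-displays u ha hb hc ab|c
... | inj₂ (inj₁ ac|b) with refute-cherry u ha hb hc a≢b a≢c b≢c ac|b _ (SetOf₃-list a b c)
...   | s , phylo , explains , ¬ab|c , _ = ⊥-elim (¬ab|c (forced s phylo explains))
informative-displayed t (_ , u) a b c (ma , mb , mc , a≢b , a≢c , b≢c , forced)
  | pa , ha | pb , hb | pc , hc | inj₂ (inj₂ (inj₁ bc|a))
  with refute-cherry u hb ha hc (≢-sym a≢b) b≢c a≢c bc|a _ (SetOf₃-swap (SetOf₃-list a b c))
... | s , phylo , explains , _ , ¬ab|c = ⊥-elim (¬ab|c (forced s phylo explains))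
informative-displayed t (_ , u) a b c (ma , mb , mc , a≢b , a≢c , b≢c , forced)
  | pa , ha | pb , hb | pc , hc | inj₂ (inj₂ (inj₂ star))
  with refute-star u ha hb hc a≢b a≢c b≢c star _ (SetOf₃-list a b c)
... | s , phylo , explains , ¬ab|c = ⊥-elim (¬ab|c (forced s phylo explains))

-- Part 2.  A structural description of 𝒳 that is stable under local tree surgery.

data OneTo : Tree → ℕ → Set where
  one : ∀ {cs b c y} → (b , c) ∈ cs → y ∈ leaves c → (b ≡ true ⊎ OneTo c y) → OneTo (node cs) y

data XR : Tree → ℕ → ℕ → Set where
  inside : ∀ {cs b c x y} → (b , c) ∈ cs → x ∈ leaves c → y ∈ leaves c → XR c x y → XR (node cs) x y
  across : ∀ {cs b c x y} → (b , c) ∈ cs → y ∈ leaves c → (b ≡ true ⊎ OneTo c y) →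
           x ∈ leavesL cs → x ∉ leaves c → XR (node cs) x y

∈⇒!! : ∀ {A : Set} {w : A} {xs} → w ∈ xs → Σ ℕ λ i → xs !! i ≡ just w
∈⇒!! (here refl) = 0 , refl
∈⇒!! (there m) with ∈⇒!! m
... | i , e = suc i , e

!!⇒∈ : ∀ {A : Set} {w : A} xs {i} → xs !! i ≡ just w → w ∈ xs
!!⇒∈ (x ∷ xs) {zero} refl = here refl
!!⇒∈ (x ∷ xs) {suc i} e = there (!!⇒∈ xs e)

∈-child-leaves : ∀ {x cs b c} → (b , c) ∈ cs → x ∈ leaves c → x ∈ leavesL cs
∈-child-leaves {cs = cs} m mx = child-leaves-⊆ cs (proj₂ (∈⇒!! m)) mx

∨-true⁻ : ∀ b {r} → b ∨ r ≡ true → (b ≡ true) ⊎ (r ≡ true)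
∨-true⁻ true _ = inj₁ refl
∨-true⁻ false e = inj₂ e

same-child : ∀ cs {i j b b' c c' y} → Unique (leavesL cs) → cs !! i ≡ just (b , c) → cs !! j ≡ just (b' , c') →
  y ∈ leaves c → y ∈ leaves c' → (i ≡ j) × (b ≡ b') × (c ≡ c')
same-child cs u e e' m m' with child-index-unique cs u e e' m m'
... | refl with trans (sym e) e'
... | refl = refl , refl , refl

OneTo⇒onePath : ∀ {t y q} → Unique (leaves t) → LeafAt t y q → OneTo t y → onePath t q ≡ true
OneTo⇒onePath {node cs} u (there {b = bk} e h) (one m my cond) with ∈⇒!! m
... | _ , e' with same-child cs u e' e my (leafAt-∈ h)
... | refl , refl , refl with cond
... | inj₁ refl = onePath-∷ {cs} _ e
... | inj₂ o = trans (onePath-∷ {cs} _ e) (trans (cong (bk ∨_) (OneTo⇒onePath (unique-child cs u e) h o)) (∨-zeroʳ bk))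

onePath⇒OneTo : ∀ {t y q} → LeafAt t y q → onePath t q ≡ true → OneTo t y
onePath⇒OneTo {node cs} (there {b = bk} e h) o with ∨-true⁻ bk (trans (sym (onePath-∷ {cs} _ e)) o)
... | inj₁ bk≡true = one (!!⇒∈ cs e) (leafAt-∈ h) (inj₁ bk≡true)
... | inj₂ o' = one (!!⇒∈ cs e) (leafAt-∈ h) (inj₂ (onePath⇒OneTo h o'))

XR⇒onePath : ∀ {t x y} m {i j qx qy S} → Unique (leaves t) →
  LeafAt t x (m ++ i ∷ qx) → LeafAt t y (m ++ j ∷ qy) → i ≢ j → t ∋[ m ] S →
  XR t x y → onePath S (j ∷ qy) ≡ true
XR⇒onePath {node cs} [] u (there ei hx) (there ej hy) i≢j here (inside m mx my _) with ∈⇒!! m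
... | _ , ek with same-child cs u ek ei mx (leafAt-∈ hx) | same-child cs u ek ej my (leafAt-∈ hy)
... | refl , _ | refl , _ = ⊥-elim (i≢j refl)
XR⇒onePath {node cs} [] {qy = qy} u _ (there {b = bj} ej hy) _ here (across m my cond _ _) with ∈⇒!! m
... | _ , ek with same-child cs u ek ej my (leafAt-∈ hy)
... | refl , refl , refl with cond
... | inj₁ refl = onePath-∷ {cs} qy ej
... | inj₂ o = trans (onePath-∷ {cs} qy ej) (trans (cong (bj ∨_) (OneTo⇒onePath (unique-child cs u ej) hy o)) (∨-zeroʳ bj))
XR⇒onePath {node cs} (l ∷ m) u (there el hx) (there el' hy) i≢j (there el'' hS) (inside mm mx my xr) with ∈⇒!! mm
... | _ , ek with same-child cs u ek el mx (leafAt-∈ hx) | trans (sym el) el' | trans (sym el) el''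
... | refl , refl , refl | refl | refl = XR⇒onePath m (unique-child cs u el) hx hy i≢j hS xr
XR⇒onePath {node cs} (l ∷ m) u (there el hx) (there el' hy) _ (there _ _) (across mm my _ _ x∉) with ∈⇒!! mm
... | _ , ek with same-child cs u ek el' my (leafAt-∈ hy) | trans (sym el) el'
... | refl , refl , refl | refl = ⊥-elim (x∉ (leafAt-∈ hx))

onePath⇒XR : ∀ {t x y} m {i j qx qy S} → Unique (leaves t) →
  LeafAt t x (m ++ i ∷ qx) → LeafAt t y (m ++ j ∷ qy) → i ≢ j → t ∋[ m ] S →
  onePath S (j ∷ qy) ≡ true → XR t x y
onePath⇒XR {node cs} [] {qy = qy} u (there ei hx) (there {b = bj} ej hy) i≢j here o =
  across (!!⇒∈ cs ej) (leafAt-∈ hy) cond (child-leaves-⊆ cs ei (leafAt-∈ hx))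
    (λ mx → i≢j (child-index-unique cs u ei ej (leafAt-∈ hx) mx))
  where
  cond : bj ≡ true ⊎ OneTo _ _
  cond with ∨-true⁻ bj (trans (sym (onePath-∷ {cs} qy ej)) o)
  ... | inj₁ e = inj₁ e
  ... | inj₂ o' = inj₂ (onePath⇒OneTo hy o')
onePath⇒XR {node cs} (l ∷ m) u (there el hx) (there el' hy) i≢j (there el'' hS) o
  with trans (sym el) el' | trans (sym el) el''
... | refl | refl = inside (!!⇒∈ cs el) (leafAt-∈ hx) (leafAt-∈ hy) (onePath⇒XR m (unique-child cs u el) hx hy i≢j hS o)

XR-endpoints : ∀ {t x y} → XR t x y → (x ∈ leaves t) × (y ∈ leaves t) × (x ≢ y)
XR-endpoints (inside m mx my xr) = ∈-child-leaves m mx , ∈-child-leaves m my , proj₂ (proj₂ (XR-endpoints xr))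
XR-endpoints (across m my _ mx x∉) = mx , ∈-child-leaves m my , λ { refl → x∉ my }

-- XR describes 𝒳 exactly: both agree with the onePath description at the branching vertex
X⇔XR : ∀ {t} → Unique (leaves t) → ∀ x y → X t x y ⇔ XR t x y
X⇔XR {t} u x y = mk⇔ to′ from′
  where
  to′ : X t x y → XR t x y
  to′ h@(x≢y , px , py , _ , hx , hy , _) with branch px py (leaves-incomparable hx hy x≢y)
  ... | E , _ , _ , _ , _ , j≢j' , refl , refl =
    onePath⇒XR E u hx hy j≢j' (subtree-at E hx) (to (X⇔onePath E u hx hy j≢j' (subtree-at E hx)) h)
  from′ : XR t x y → X t x y
  from′ xr with XR-endpoints xr
  ... | mx , my , x≢y with leaf-address t mx | leaf-address t my
  ... | px , hx | py , hy with branch px py (leaves-incomparable hx hy x≢y)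
  ... | E , _ , _ , _ , _ , j≢j' , refl , refl =
    from (X⇔onePath E u hx hy j≢j' (subtree-at E hx)) (XR⇒onePath E u hx hy j≢j' (subtree-at E hx) xr)

Child : Set
Child = Bool × Tree

!!-split : ∀ {A : Set} (cs : List A) i {v} → cs !! i ≡ just v → cs ≡ take i cs ++ v ∷ drop (suc i) cs
!!-split (x ∷ cs) zero refl = refl
!!-split (x ∷ cs) (suc i) e = cong (x ∷_) (!!-split cs i e)

upd-split : ∀ {A : Set} (cs : List A) i {v w} → cs !! i ≡ just v → upd cs i w ≡ take i cs ++ w ∷ drop (suc i) cs
upd-split (x ∷ cs) zero refl = refl
upd-split (x ∷ cs) (suc i) e = cong (x ∷_) (upd-split cs i e)

leavesL-++ : ∀ (xs ys : List Child) → leavesL (xs ++ ys) ≡ leavesL xs ++ leavesL ys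
leavesL-++ [] ys = refl
leavesL-++ ((b , c) ∷ xs) ys = trans (cong (leaves c ++_) (leavesL-++ xs ys)) (sym (++-assoc (leaves c) _ _))

∈-replace : ∀ {A : Set} {w : A} L₁ M M' L₂ → w ∈ L₁ ++ M ++ L₂ → (w ∈ M) ⊎ (w ∈ L₁ ++ M' ++ L₂)
∈-replace L₁ M M' L₂ m with ∈-++⁻ L₁ m
... | inj₁ m₁ = inj₂ (∈-++⁺ˡ m₁)
... | inj₂ m₂ with ∈-++⁻ M m₂
...   | inj₁ m₃ = inj₁ m₃
...   | inj₂ m₄ = inj₂ (∈-++⁺ʳ L₁ (∈-++⁺ʳ M' m₄))

∈-middle : ∀ {A : Set} {w : A} L₁ {M} L₂ → w ∈ M → w ∈ L₁ ++ M ++ L₂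
∈-middle L₁ L₂ m = ∈-++⁺ʳ L₁ (∈-++⁺ˡ m)

OneVia : Bool → Tree → ℕ → Set
OneVia b c y = b ≡ true ⊎ OneTo c y

OneVia-map : ∀ {b c c' y} → (OneTo c y → OneTo c' y) → OneVia b c y → OneVia b c' y
OneVia-map f (inj₁ e) = inj₁ e
OneVia-map f (inj₂ o) = inj₂ (f o)

-- everything 𝒳 can see of c hanging below an edge labelled b is also seen for c'
record Simulates (b : Bool) (c c' : Tree) : Set where
  field
    same-leaves : leaves c ≡ leaves c'
    XR-⊆ : ∀ {x y} → XR c x y → XR c' x y
    OneVia-⊆ : ∀ {y} → OneVia b c y → OneVia b c' y
open Simulates

Interchangeable : Bool → Tree → Tree → Set
Interchangeable b c c' = Simulates b c c' × Simulates b c' c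

-- the edge into node ds, labelled b, is redundant for 𝒳: it is a 0-edge, or every
-- leaf below it already sees a 1-edge further down
Redundant : Bool → List Child → Set
Redundant b ds = b ≡ false ⊎ (∀ y → y ∈ leavesL ds → OneTo (node ds) y)

module ContractInner (L₁ L₂ : List Child) (bi : Bool) (ds : List Child) (redundant : Redundant bi ds) where
  cs cs' : List Child
  cs = L₁ ++ (bi , node ds) ∷ L₂
  cs' = L₁ ++ ds ++ L₂

  leq : leavesL cs ≡ leavesL cs'
  leq = trans (leavesL-++ L₁ _) (sym (trans (leavesL-++ L₁ (ds ++ L₂)) (cong (leavesL L₁ ++_) (leavesL-++ ds L₂))))

  contracted : (bi , node ds) ∈ cs
  contracted = ∈-middle L₁ L₂ (here refl)

  through-edge : ∀ {y} → OneVia bi (node ds) y → y ∈ leavesL ds → OneTo (node ds) y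
  through-edge (inj₂ o) _ = o
  through-edge (inj₁ refl) my = all-one redundant
    where
    all-one : Redundant true ds → OneTo (node ds) _
    all-one (inj₂ all-one′) = all-one′ _ my

  XR⁺ : ∀ {x y} → XR (node cs) x y → XR (node cs') x y
  XR⁺ (inside m mx my xr) with ∈-replace L₁ ((bi , node ds) ∷ []) ds L₂ m
  ... | inj₂ m' = inside m' mx my xr
  ... | inj₁ (here refl) with xr
  ...   | inside m' mx' my' xr' = inside (∈-middle L₁ L₂ m') mx' my' xr'
  ...   | across m' my' cond mx' x∉ =
          across (∈-middle L₁ L₂ m') my' cond (subst (_ ∈_) leq (∈-child-leaves contracted mx')) x∉
  XR⁺ (across m my cond mx x∉) with ∈-replace L₁ ((bi , node ds) ∷ []) ds L₂ m
  ... | inj₂ m' = across m' my cond (subst (_ ∈_) leq mx) x∉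
  ... | inj₁ (here refl) with through-edge cond my
  ...   | one m'' my'' cond'' =
          across (∈-middle L₁ L₂ m'') my'' cond'' (subst (_ ∈_) leq mx) (λ mx'' → x∉ (∈-child-leaves m'' mx''))

  XR⁻ : ∀ {x y} → XR (node cs') x y → XR (node cs) x y
  XR⁻ (inside m mx my xr) with ∈-replace L₁ ds ((bi , node ds) ∷ []) L₂ m
  ... | inj₂ m' = inside m' mx my xr
  ... | inj₁ m' = inside contracted (∈-child-leaves m' mx) (∈-child-leaves m' my) (inside m' mx my xr)
  XR⁻ {x} (across m my cond mx x∉) with ∈-replace L₁ ds ((bi , node ds) ∷ []) L₂ m
  ... | inj₂ m' = across m' my cond (subst (_ ∈_) (sym leq) mx) x∉
  ... | inj₁ m' with x ∈? leavesL ds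
  ...   | yes mx' = inside contracted mx' (∈-child-leaves m' my) (across m' my cond mx' x∉)
  ...   | no x∉' = across contracted (∈-child-leaves m' my) (inj₂ (one m' my cond)) (subst (_ ∈_) (sym leq) mx) x∉'

  OneTo⁺ : ∀ {y} → OneTo (node cs) y → OneTo (node cs') y
  OneTo⁺ (one m my cond) with ∈-replace L₁ ((bi , node ds) ∷ []) ds L₂ m
  ... | inj₂ m' = one m' my cond
  ... | inj₁ (here refl) with through-edge cond my
  ...   | one m'' my'' cond'' = one (∈-middle L₁ L₂ m'') my'' cond''

  OneTo⁻ : ∀ {y} → OneTo (node cs') y → OneTo (node cs) y
  OneTo⁻ (one m my cond) with ∈-replace L₁ ds ((bi , node ds) ∷ []) L₂ m
  ... | inj₂ m' = one m' my cond
  ... | inj₁ m' = one contracted (∈-child-leaves m' my) (inj₂ (one m' my cond))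

  interchangeable : ∀ b → Interchangeable b (node cs) (node cs')
  interchangeable b = record { same-leaves = leq ; XR-⊆ = XR⁺ ; OneVia-⊆ = OneVia-map OneTo⁺ }
                    , record { same-leaves = sym leq ; XR-⊆ = XR⁻ ; OneVia-⊆ = OneVia-map OneTo⁻ }

module ReplaceChild (L₁ L₂ : List Child) (b : Bool) (c c' : Tree) (sim : Simulates b c c') where
  cs cs' : List Child
  cs = L₁ ++ (b , c) ∷ L₂
  cs' = L₁ ++ (b , c') ∷ L₂

  leq : leavesL cs ≡ leavesL cs'
  leq = trans (leavesL-++ L₁ _)
    (trans (cong (λ z → leavesL L₁ ++ (z ++ leavesL L₂)) (same-leaves sim)) (sym (leavesL-++ L₁ _)))

  replaced : (b , c') ∈ cs'
  replaced = ∈-middle L₁ L₂ (here refl)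

  XR⁺ : ∀ {x y} → XR (node cs) x y → XR (node cs') x y
  XR⁺ (inside m mx my xr) with ∈-replace L₁ ((b , c) ∷ []) ((b , c') ∷ []) L₂ m
  ... | inj₂ m' = inside m' mx my xr
  ... | inj₁ (here refl) =
        inside replaced (subst (_ ∈_) (same-leaves sim) mx) (subst (_ ∈_) (same-leaves sim) my) (XR-⊆ sim xr)
  XR⁺ (across m my cond mx x∉) with ∈-replace L₁ ((b , c) ∷ []) ((b , c') ∷ []) L₂ m
  ... | inj₂ m' = across m' my cond (subst (_ ∈_) leq mx) x∉
  ... | inj₁ (here refl) = across replaced (subst (_ ∈_) (same-leaves sim) my) (OneVia-⊆ sim cond)
        (subst (_ ∈_) leq mx) (λ m' → x∉ (subst (_ ∈_) (sym (same-leaves sim)) m'))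

  OneTo⁺ : ∀ {y} → OneTo (node cs) y → OneTo (node cs') y
  OneTo⁺ (one m my cond) with ∈-replace L₁ ((b , c) ∷ []) ((b , c') ∷ []) L₂ m
  ... | inj₂ m' = one m' my cond
  ... | inj₁ (here refl) = one replaced (subst (_ ∈_) (same-leaves sim) my) (OneVia-⊆ sim cond)

  simulates : ∀ b₀ → Simulates b₀ (node cs) (node cs')
  simulates b₀ = record { same-leaves = leq ; XR-⊆ = XR⁺ ; OneVia-⊆ = OneVia-map OneTo⁺ }

contract-at : ∀ cs i {bi ds} b → cs !! i ≡ just (bi , node ds) → Redundant bi ds →
  Interchangeable b (node cs) (node (splice cs i ds))
contract-at cs i {bi} {ds} b e redundant =
  subst (λ z → Interchangeable b (node z) (node (splice cs i ds))) (sym (!!-split cs i e))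
    (ContractInner.interchangeable (take i cs) (drop (suc i) cs) bi ds redundant b)

replace-at : ∀ cs k {bk ck ck'} b₀ → cs !! k ≡ just (bk , ck) → Interchangeable bk ck ck' →
  Interchangeable b₀ (node cs) (node (upd cs k (bk , ck')))
replace-at cs k {bk} {ck} {ck'} b₀ e (sim , sim⁻¹) =
  subst₂ (λ z w → Interchangeable b₀ (node z) (node w)) (sym (!!-split cs k e)) (sym (upd-split cs k e))
    (ReplaceChild.simulates L₁ L₂ bk ck ck' sim b₀ , ReplaceChild.simulates L₁ L₂ bk ck' ck sim⁻¹ b₀)
  where
  L₁ = take k cs
  L₂ = drop (suc k) cs

contract-below : ∀ {c q cs i bi ds} → c ∋[ q ] node cs → cs !! i ≡ just (bi , node ds) → Redundant bi ds →
  ∀ b → Σ Tree λ c' → StepNR b c b c' × Interchangeable b c c'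
contract-below {cs = cs} {i} here e redundant b = _ , top (inner e) , contract-at cs i b e redundant
contract-below (there {cs = cs₀} {i = k} {b = bk} el h) e redundant b with contract-below h e redundant bk
... | _ , step , iv = _ , deeper el step , replace-at cs₀ k b el iv

contract : ∀ {t q cs i bi ds} → t ∋[ q ] node cs → cs !! i ≡ just (bi , node ds) → Redundant bi ds →
  Σ Tree λ t' → Step t t' × Interchangeable false t t'
contract {cs = cs} {i} here e redundant = _ , top (inner e) , contract-at cs i false e redundant
contract (there {cs = cs₀} {i = k} {b = bk} el h) e redundant with contract-below h e redundant bk
... | _ , step , iv = _ , deeper el step , replace-at cs₀ k false el iv

interchangeable-explains : ∀ {t t' b} → Unique (leaves t) → Interchangeable b t t' → Explains t' (X t) (leaves t)
interchangeable-explains {t} {t'} u (sim , sim⁻¹) = same , rel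
  where
  u' : Unique (leaves t')
  u' = subst Unique (same-leaves sim) u
  same : SameSet (leaves t') (leaves t)
  same z = mk⇔ (subst (_ ∈_) (same-leaves sim⁻¹)) (subst (_ ∈_) (same-leaves sim))
  rel : ∀ x y → X t' x y ⇔ X t x y
  rel x y = mk⇔ (λ h → from (X⇔XR u x y) (XR-⊆ sim⁻¹ (to (X⇔XR u' x y) h)))
                (λ h → from (X⇔XR u' x y) (XR-⊆ sim (to (X⇔XR u x y) h)))

-- Least-resolved trees: every inner edge is a 1-edge, and some leaf below it sees
-- no further 1-edge (otherwise contracting the edge would still explain 𝒳).

OneTo-∈ : ∀ {T y} → OneTo T y → y ∈ leaves T
OneTo-∈ (one m my _) = ∈-child-leaves m my

OneTo? : ∀ T → Unique (leaves T) → ∀ y → Dec (OneTo T y)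
OneTo? T u y with y ∈? leaves T
... | no y∉ = no (λ o → y∉ (OneTo-∈ o))
... | yes my with leaf-address T my
...   | q , hq with onePath T q in eq
...     | true = yes (onePath⇒OneTo hq eq)
...     | false = no (λ o → false≢true (trans (sym eq) (OneTo⇒onePath u hq o)))
  where
  false≢true : false ≢ true
  false≢true ()

all-or-blind-leaf : ∀ T → Unique (leaves T) →
  (∀ y → y ∈ leaves T → OneTo T y) ⊎ (Σ ℕ λ y → (y ∈ leaves T) × ¬ OneTo T y)
all-or-blind-leaf T u with all? (OneTo? T u) (leaves T)
... | yes all-one = inj₁ (λ y my → All.lookup all-one my)
... | no ¬all-one = inj₂ (find (¬All⇒Any¬ (OneTo? T u) (leaves T) ¬all-one))

least-resolved-inner-edge : ∀ {t q cs i bi ds} → Phylo t → LeastResolved t →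
  t ∋[ q ] node cs → cs !! i ≡ just (bi , node ds) →
  (bi ≡ true) × (Σ ℕ λ y → (y ∈ leavesL ds) × ¬ OneTo (node ds) y)
least-resolved-inner-edge {bi = false} (_ , u) lr h e with contract h e (inj₁ refl)
... | t' , step , iv = ⊥-elim (lr t' step (interchangeable-explains u iv))
least-resolved-inner-edge {bi = true} {ds} (_ , u) lr h e
  with all-or-blind-leaf (node ds) (unique-subtree u (∋-++ h (there e here)))
... | inj₂ blind = refl , blind
... | inj₁ all-one with contract h e (inj₂ all-one)
...   | t' , step , iv = ⊥-elim (lr t' step (interchangeable-explains u iv))

XR⇒OneTo : ∀ {T x y} → XR T x y → OneTo T y
XR⇒OneTo (inside m _ my xr) = one m my (inj₂ (XR⇒OneTo xr))
XR⇒OneTo (across m my cond _ _) = one m my cond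

XR-restrict : ∀ {t p S x y} → Unique (leaves t) → t ∋[ p ] S → x ∈ leaves S → y ∈ leaves S → XR t x y → XR S x y
XR-restrict u here mx my xr = xr
XR-restrict {node cs} u (there el h) mx my (inside m mx' _ xr) with ∈⇒!! m
... | _ , ek with same-child cs u ek el mx' (subtree-leaves-⊆ h mx)
... | refl , refl , refl = XR-restrict (unique-child cs u el) h mx my xr
XR-restrict {node cs} u (there el h) mx my (across m my' _ _ x∉) with ∈⇒!! m
... | _ , ek with same-child cs u ek el my' (subtree-leaves-⊆ h my)
... | refl , refl , refl = ⊥-elim (x∉ (subtree-leaves-⊆ h mx))

OneTo-below-1-edge : ∀ {T q cs i c y} → T ∋[ q ] node cs → cs !! i ≡ just (true , c) → y ∈ leaves c → OneTo T y
OneTo-below-1-edge {cs = cs} here e my = one (!!⇒∈ cs e) my (inj₁ refl)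
OneTo-below-1-edge {cs = cs} (there {cs = cs₀} el h) e my =
  one (!!⇒∈ cs₀ el) (subtree-leaves-⊆ h (child-leaves-⊆ cs e my)) (inj₂ (OneTo-below-1-edge h e my))

XR-across-1-edge : ∀ {T q cs i c y z} → T ∋[ q ] node cs → cs !! i ≡ just (true , c) → y ∈ leaves c →
  z ∈ leaves T → z ∉ leaves c → XR T z y
XR-across-1-edge {cs = cs} here e my mz z∉ = across (!!⇒∈ cs e) my (inj₁ refl) mz z∉
XR-across-1-edge {cs = cs} {z = z} (there {cs = cs₀} {c = ck} el h) e my mz z∉ with z ∈? leaves ck
... | yes mz' = inside (!!⇒∈ cs₀ el) mz' (subtree-leaves-⊆ h (child-leaves-⊆ cs e my)) (XR-across-1-edge h e my mz' z∉)
... | no z∉' = across (!!⇒∈ cs₀ el) (subtree-leaves-⊆ h (child-leaves-⊆ cs e my)) (inj₂ (OneTo-below-1-edge h e my)) mz z∉'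

-- Informative triples from 𝒳.  Moving the branching point of a leaf upwards along
-- the path to y can only add 1-edges.

X-same-branch : ∀ {s x y c} m {i j k qx qy qc} → Unique (leaves s) →
  LeafAt s x (m ++ i ∷ qx) → LeafAt s y (m ++ j ∷ qy) → LeafAt s c (m ++ k ∷ qc) → i ≢ j → k ≢ j →
  X s c y → X s x y
X-same-branch m u hx hy hc i≢j k≢j Xcy =
  from (X⇔onePath m u hx hy i≢j (subtree-at m hx)) (to (X⇔onePath m u hc hy k≢j (subtree-at m hx)) Xcy)

X-higher-branch : ∀ {s x y c} m {i k e j j' qx qy qc} → Unique (leaves s) →
  LeafAt s x (m ++ k ∷ qx) → LeafAt s y (m ++ i ∷ e ++ j ∷ qy) → LeafAt s c (m ++ i ∷ e ++ j' ∷ qc) →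
  k ≢ i → j' ≢ j → X s c y → X s x y
X-higher-branch m {i} {k} {e} {j} {j'} {qx} {qy} {qc} u hx hy hc k≢i j'≢j Xcy =
  from (X⇔onePath m u hx hy k≢i hS) (begin
    onePath S (i ∷ e ++ j ∷ qy)            ≡⟨ onePath-++ (i ∷ e) (j ∷ qy) hSW ⟩
    onePath S (i ∷ e) ∨ onePath W (j ∷ qy) ≡⟨ cong (onePath S (i ∷ e) ∨_) below ⟩
    onePath S (i ∷ e) ∨ true               ≡⟨ ∨-zeroʳ _ ⟩
    true                                   ∎)
  where
  open ≡-Reasoning
  S = subtree m hy
  hS = subtree-at m hy
  W = subtree (i ∷ e) (subtree-∋ m hy)
  hSW = subtree-at (i ∷ e) (subtree-∋ m hy)
  below = to (X⇔onePath (m ++ i ∷ e) u (cherry-addr m i e j' qc hc) (cherry-addr m i e j qy hy) j'≢j (∋-++ hS hSW)) Xcy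

-- In any tree with (c , y) ∈ 𝒳 and (x , y) ∉ 𝒳 the topology on {x, y, c} is xy|c,
-- since every other topology would force (x , y) ∈ 𝒳.
displays-by-X : ∀ {s x y c} → Unique (leaves s) → x ∈ leaves s → y ∈ leaves s → c ∈ leaves s →
  x ≢ y → x ≢ c → y ≢ c → X s c y → ¬ X s x y → Displays s x y c
displays-by-X {s} u mx my mc x≢y x≢c y≢c Xcy ¬Xxy
  with leaf-address s mx | leaf-address s my | leaf-address s mc
... | px , hx | py , hy | pc , hc
  with topology px py pc (leaves-incomparable hx hy x≢y) (leaves-incomparable hx hc x≢c) (leaves-incomparable hy hc y≢c)
... | inj₁ xy|c = cherry-displays u hx hy hc xy|c
... | inj₂ (inj₁ (m , i , k , _ , _ , _ , _ , _ , _ , i≢k , _ , refl , refl , refl)) =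
  ⊥-elim (¬Xxy (X-same-branch m u hx hy hc i≢k i≢k Xcy))
... | inj₂ (inj₂ (inj₁ (m , i , k , _ , _ , _ , _ , _ , _ , i≢k , j≢j' , refl , refl , refl))) =
  ⊥-elim (¬Xxy (X-higher-branch m u hx hy hc (≢-sym i≢k) (≢-sym j≢j') Xcy))
... | inj₂ (inj₂ (inj₂ (m , _ , _ , _ , _ , _ , _ , i≢j , _ , j≢k , refl , refl , refl))) =
  ⊥-elim (¬Xxy (X-same-branch m u hx hy hc i≢j (≢-sym j≢k) Xcy))

informative-by-X : ∀ {t x y c} → x ∈ leaves t → y ∈ leaves t → c ∈ leaves t → x ≢ y → x ≢ c → y ≢ c →
  X t c y → ¬ X t x y → Informative (X t) (leaves t) x y c
informative-by-X {t} {x} {y} {c} mx my mc x≢y x≢c y≢c Xcy ¬Xxy = mx , my , mc , x≢y , x≢c , y≢c , forced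
  where
  forced : ∀ s → Phylo s → Explains s (Restrict (X t) (x ∷ y ∷ c ∷ [])) (x ∷ y ∷ c ∷ []) → Displays s x y c
  forced s (_ , u) (same , rel) =
    displays-by-X u (from (same x) (here refl)) (from (same y) (there (here refl)))
      (from (same c) (there (there (here refl)))) x≢y x≢c y≢c
      (from (rel c y) (Xcy , there (there (here refl)) , there (here refl)))
      (λ h → ¬Xxy (proj₁ (to (rel x y) h)))

informative-cluster : ∀ {t k p ds} → Phylo t → LeastResolved t → t ∋[ k ∷ p ] node ds →
  Σ ℕ λ y → (y ∈ leavesL ds) × (∀ x z → x ∈ leavesL ds → x ≢ y → z ∈ leaves t → z ∉ leavesL ds →
    Informative (X t) (leaves t) x y z)
informative-cluster phylo@(_ , u) lr h with parent h
... | _ , _ , _ , _ , hq , e with least-resolved-inner-edge phylo lr hq e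
... | refl , y , my , ¬one = y , my , triples
  where
  triples : ∀ x z → _ → x ≢ y → _ → _ → _
  triples x z mx x≢y mz z∉ =
    informative-by-X (subtree-leaves-⊆ h mx) (subtree-leaves-⊆ h my) mz x≢y (λ { refl → z∉ mx }) (λ { refl → z∉ my })
      (from (X⇔XR u z y) (XR-across-1-edge hq e my mz z∉))
      (λ Xxy → ¬one (XR⇒OneTo (XR-restrict u h mx my (to (X⇔XR u x y) Xxy))))

lcp : Addr → Addr → Addr
lcp (i ∷ p) (j ∷ q) with i ≟ j
... | yes _ = i ∷ lcp p q
... | no _ = []
lcp _ _ = []

lcp-≼ˡ : ∀ p q → lcp p q ≼ p
lcp-≼ˡ [] q = []≼ []
lcp-≼ˡ (i ∷ p) [] = []≼ _
lcp-≼ˡ (i ∷ p) (j ∷ q) with i ≟ j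
... | yes _ = ≼-∷⁺ (lcp-≼ˡ p q)
... | no _ = []≼ _

lcp-≼ʳ : ∀ p q → lcp p q ≼ q
lcp-≼ʳ [] q = []≼ q
lcp-≼ʳ (i ∷ p) [] = []≼ _
lcp-≼ʳ (i ∷ p) (j ∷ q) with i ≟ j
... | yes refl = ≼-∷⁺ (lcp-≼ʳ p q)
... | no _ = []≼ _

lcp-greatest : ∀ {r} p q → r ≼ p → r ≼ q → r ≼ lcp p q
lcp-greatest {[]} p q _ _ = []≼ _
lcp-greatest {k ∷ r} [] q r≼[] _ with ≼[] r≼[]
... | ()
lcp-greatest {k ∷ r} (i ∷ p) [] _ r≼[] with ≼[] r≼[]
... | ()
lcp-greatest {k ∷ r} (i ∷ p) (j ∷ q) a b with ≼-∷⁻ a | ≼-∷⁻ b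
... | refl , a' | refl , b' with k ≟ k
...   | yes _ = ≼-∷⁺ (lcp-greatest p q a' b')
...   | no k≢k = ⊥-elim (k≢k refl)

lca-under : ∀ {t} → Unique (leaves t) → ∀ r₀ (L : List ℕ) → (∀ z → z ∈ L → z ∈ leaves t) →
  Σ Addr λ r → (r ≼ r₀) × AllBelow t L r × (∀ r' → r' ≼ r₀ → AllBelow t L r' → r' ≼ r)
lca-under u r₀ [] _ = r₀ , ≼-refl r₀ , (λ z ()) , λ r' r'≼r₀ _ → r'≼r₀
lca-under {t} u r₀ (z ∷ L) L⊆ with leaf-address t (L⊆ z (here refl))
... | qz , hz with lca-under u (lcp r₀ qz) L (λ w m → L⊆ w (there m))
... | r , r≼ , below , deepest = r , ≼-trans r≼ (lcp-≼ˡ r₀ qz) , below′ , deepest′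
  where
  below′ : AllBelow t (z ∷ L) r
  below′ w (here refl) = qz , hz , ≼-trans r≼ (lcp-≼ʳ r₀ qz)
  below′ w (there m) = below w m
  deepest′ : ∀ r' → r' ≼ r₀ → AllBelow t (z ∷ L) r' → r' ≼ r
  deepest′ r' r'≼r₀ below-r' with below-r' z (here refl)
  ... | qz' , hz' , r'≼qz' with leaf-address-unique u hz hz'
  ... | refl = deepest r' (lcp-greatest r₀ qz r'≼r₀ r'≼qz') (λ w m → below-r' w (there m))

ancestor-vertex : ∀ {t x p q} → LeafAt t x q → p ≼ q → Vertex t p
ancestor-vertex {p = p} hx (s , refl) = subtree p hx , subtree-at p hx

displayed-below-branch : ∀ {t' x y z qx} E {j j' a b} → Unique (leaves t') → Displays t' x y z →
  LeafAt t' x qx → LeafAt t' y (E ++ j ∷ a) → LeafAt t' z (E ++ j' ∷ b) → j ≢ j' → (E ++ j ∷ []) ≼ qx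
displayed-below-branch E {j} {j'} {a} {b} u (r , r' , (_ , below-xy , _) , (_ , _ , deepest-xyz) , r'≺r) hx hy hz j≢j'
  with below-xy _ (here refl) | below-xy _ (there (here refl))
... | _ , hx' , r≼qx | _ , hy' , r≼qy with leaf-address-unique u hx hx' | leaf-address-unique u hy hy'
... | refl | refl with ≼-comparable r≼qy (≼-++ E (j ∷ a))
... | inj₂ E≺r = ≼-trans (≺-≼-child j a E≺r r≼qy) r≼qx
... | inj₁ r≼E =
  ⊥-elim (≺⇒⋡ r'≺r (deepest-xyz r (below₃ hx hy hz r≼qx r≼qy (≼-trans r≼E (≼-++ E (j' ∷ b))))))

cluster-⊆ : ∀ {t'} → Unique (leaves t') → ∀ C {y qy p'} → y ∈ C → LeafAt t' y qy →
  (∀ x → x ∈ C → x ∈ leaves t') →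
  (∀ x z → x ∈ C → x ≢ y → z ∈ leaves t' → z ∉ C → Displays t' x y z) →
  (∀ r → r ≼ qy → AllBelow t' C r → r ≼ p') →
  ∀ z → InCluster t' p' z → z ∈ C
cluster-⊆ {t'} u C {y} my hy C⊆ displays deepest z (qz , hz , p'≼qz) with z ∈? C
... | yes mz = mz
... | no z∉C with branch _ qz (leaves-incomparable hy hz (λ { refl → z∉C my }))
... | E , j , j' , a , b , j≢j' , refl , refl =
  ⊥-elim (j≢j' (child-≼-injective E (≼-trans (deepest (E ++ j ∷ []) Ej≼qy C-below) p'≼qz)))
  where
  Ej≼qy : (E ++ j ∷ []) ≼ (E ++ j ∷ a)
  Ej≼qy = a , ++-assoc E (j ∷ []) a
  C-below : AllBelow t' C (E ++ j ∷ [])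
  C-below x mx with leaf-address t' (C⊆ x mx)
  ... | qx , hx with x ≟ y
  ...   | no x≢y = qx , hx , displayed-below-branch E u (displays x z mx x≢y (leafAt-∈ hz) z∉C) hx hy hz j≢j'
  ...   | yes refl with leaf-address-unique u hy hx
  ...     | refl = qx , hx , Ej≼qy

cluster-from-triples : ∀ {t'} → Unique (leaves t') → ∀ C {y} → y ∈ C → (∀ x → x ∈ C → x ∈ leaves t') →
  (∀ x z → x ∈ C → x ≢ y → z ∈ leaves t' → z ∉ C → Displays t' x y z) →
  ∃ λ p' → Vertex t' p' × (∀ z → z ∈ C ⇔ InCluster t' p' z)
cluster-from-triples {t'} u C my C⊆ displays with leaf-address t' (C⊆ _ my)
... | qy , hy with lca-under u qy C C⊆
... | p' , p'≼qy , below , deepest =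
  p' , ancestor-vertex hy p'≼qy , λ z → mk⇔ (below z) (cluster-⊆ u C my hy C⊆ displays deepest z)

refinement : ∀ t → Phylo t → LeastResolved t → ∀ t' → Phylo t' → SameSet (leaves t') (leaves t) →
  ((a b c : ℕ) → Informative (X t) (leaves t) a b c → Displays t' a b c) → Refines t' t
refinement t phylo lr t' (_ , u') same displays = same , cluster-in-t'
  where
  to-t' : ∀ {z} → z ∈ leaves t → z ∈ leaves t'
  to-t' {z} = from (same z)
  cluster-in-t' : ∀ p → Vertex t p → ∃ λ p' → Vertex t' p' × (∀ x → InCluster t p x ⇔ InCluster t' p' x)
  cluster-in-t' p (leaf x , h) with leaf-address t' (to-t' (leafAt-∈ h))
  ... | q' , h' = q' , (leaf x , h') , λ z →
    mk⇔ (λ c → from (cluster-leaf h') (to (cluster-leaf h) c)) (λ c → from (cluster-leaf h) (to (cluster-leaf h') c))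
  cluster-in-t' [] (node ds , here) = [] , (t' , here) , λ z →
    mk⇔ (λ c → from (cluster-subtree here) (to-t' (to (cluster-subtree here) c)))
        (λ c → from (cluster-subtree here) (to (same z) (to (cluster-subtree here) c)))
  cluster-in-t' (k ∷ p) (node ds , h) with informative-cluster phylo lr h
  ... | y , my , informative with cluster-from-triples u' (leavesL ds) my (λ x mx → to-t' (subtree-leaves-⊆ h mx))
        (λ x z mx x≢y mz z∉ → displays x y z (informative x z mx x≢y (to (same z) mz) z∉))
  ... | p' , v' , C⇔ = p' , v' , λ z →
    mk⇔ (λ c → to (C⇔ z) (to (cluster-subtree h) c)) (λ c → from (cluster-subtree h) (from (C⇔ z) c))

lemma12 : (t : Tree) → Phylo t → LeastResolved t →
    ((a b c : ℕ) → Informative (X t) (leaves t) a b c → Displays t a b c) ×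
    ((t' : Tree) → Phylo t' → SameSet (leaves t') (leaves t) →
    ((a b c : ℕ) → Informative (X t) (leaves t) a b c → Displays t' a b c) →
    Refines t' t)
lemma12 t phylo lr = informative-displayed t phylo , refinement t phylo lr
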